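{- Let $\sigma\in\mathfrak{S}_n$ and suppose $\sigma=\alpha_1\alpha_2\cdots\alpha_i\beta$ where each $\alpha_j$ is an L-hook of length $\ge2$ and $\beta$ is an L-hook or an F-hook, such that, writing $x_k$ for the last letter of $\alpha_k$ and $\beta_1$ for the first letter of $\beta$, one has $x_1>x_2>\cdots>x_i>\beta_1$, and such that $\beta_1$ is the greatest descent top of $\beta$ whenever $\beta$ is not an increasing word. Then this factorization coincides with the rix-factorization of $\sigma$; in particular such a factorization is unique.
   Context: Words have distinct letters from $[n]$. A letter $w_i$ of $w=w_1\cdots w_k$ is a descent top if $w_i>w_{i+1}$. A word of length 1 is an L-hook; a word of length $\ge2$ is an L-hook (resp. F-hook) if its last (resp. first) letter is its greatest letter. The rix-factorization of $\sigma\in\mathfrak{S}_n$ is the factorization $\sigma=\alpha_1\cdots\alpha_i\beta$ obtained by the algorithm: (1) $w\leftarrow\sigma$, $i\leftarrow0$; (2) if $w$ is increasing, set $\beta=w$ and stop; otherwise $i\leftarrow i+1$, let $x$ be the greatest descent top of $w$ and write $w=w'xw''$; (3) if $w'$ is empty, set $\beta=w$ and stop; otherwise set $\alpha_i=w'x$, $w\leftarrow w''$, and go to (2). -}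

module Defs where

open import Data.Nat using (ℕ; _≤_; _<_; _>_)
open import Data.List using (List; []; _∷_; _++_; [_]; length; map; upTo; concat)
open import Data.List.Relation.Unary.All using (All)
open import Data.List.Relation.Unary.Linked using (Linked)
open import Data.List.Relation.Binary.Permutation.Propositional using (_↭_)
open import Data.Product using (Σ; ∃; ∃-syntax; _×_)
open import Data.Sum using (_⊎_)
open import Relation.Binary.PropositionalEquality using (_≡_)
open import Relation.Nullary using (¬_)

-- σ is a permutation of [n] = {1,…,n}, written in one-line notation.
IsPerm : ℕ → List ℕ → Set
IsPerm n σ = σ ↭ map ℕ.suc (upTo n)
  where import Data.Nat as ℕ

Increasing : List ℕ → Set
Increasing w = Linked _<_ w

DescentTop : List ℕ → ℕ → Set
DescentTop w x = ∃[ u ] ∃[ y ] ∃[ v ] (w ≡ u ++ x ∷ y ∷ v × x > y)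

GreatestDescentTop : List ℕ → ℕ → Set
GreatestDescentTop w x = DescentTop w x × (∀ y → DescentTop w y → y ≤ x)

LHook : List ℕ → Set
LHook w = (∃[ a ] w ≡ [ a ])
        ⊎ (2 ≤ length w × ∃[ u ] ∃[ x ] (w ≡ u ++ [ x ] × All (_≤ x) w))

FHook : List ℕ → Set
FHook w = 2 ≤ length w × ∃[ x ] ∃[ u ] (w ≡ x ∷ u × All (_≤ x) w)

-- last letter of a word (default used only for the empty word)
lastOr : ℕ → List ℕ → ℕ
lastOr d [] = d
lastOr d (a ∷ w) = lastOr a w

-- The rix-factorization algorithm, as a relation:
-- Rix w αs β  means that running the algorithm on w yields
-- w = α₁ ⋯ αᵢ β with αs = α₁ ∷ … ∷ αᵢ.
data Rix : List ℕ → List (List ℕ) → List ℕ → Set where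
  stop-inc   : ∀ {w} → Increasing w → Rix w [] w
  stop-empty : ∀ {x w''} → ¬ Increasing (x ∷ w'') →
               GreatestDescentTop (x ∷ w'') x → Rix (x ∷ w'') [] (x ∷ w'')
  step       : ∀ {a w' x w'' αs β} → ¬ Increasing ((a ∷ w') ++ x ∷ w'') →
               GreatestDescentTop ((a ∷ w') ++ x ∷ w'') x →
               Rix w'' αs β →
               Rix ((a ∷ w') ++ x ∷ w'') (((a ∷ w') ++ [ x ]) ∷ αs) β

module Submission where

open import Defs
open import Data.Nat using (ℕ; _≤_; _<_; _>_; s≤s)
open import Data.Nat.Properties using (<⇒≤; <-asym; <-trans; ≤-<-trans; _<?_)
open import Data.List using (List; []; _∷_; _++_; [_]; length; map; concat)
open import Data.List.Properties using (++-assoc; ∷-injectiveˡ; ∷-injectiveʳ)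
open import Data.List.Relation.Unary.All using (All; _∷_)
open import Data.List.Relation.Unary.Linked as Linked using (Linked; _∷_; linked?)
open import Data.Product using (_×_; _,_; ∃; proj₁; proj₂)
open import Data.Sum using (_⊎_; inj₁; inj₂; [_,_]′)
open import Function using (id)
open import Relation.Binary.PropositionalEquality using (_≡_; refl; subst; sym)
open import Relation.Nullary using (¬_; yes; no)

-- Every descent top of σ = α₁ ⋯ αᵢ β lies in some hook αⱼ or in β.  A letter
-- of αⱼ is at most xⱼ ≤ x₁, and a descent top of β is at most β₁ < x₁; so x₁,
-- which is a descent top because the next factor starts below it, is the
-- greatest one and the algorithm cuts exactly after α₁.  Inductively the same
-- holds for α₂ ⋯ αᵢ β.

descentTop-++⁻ : ∀ {x y} (P Q : List ℕ) → All (_≤ x) P →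
                 DescentTop (P ++ Q) y → y ≤ x ⊎ DescentTop Q y
descentTop-++⁻ []      Q _           d                    = inj₂ d
descentTop-++⁻ (p ∷ P) Q (p≤x ∷ _)   ([] , _ , _ , eq , _) =
  inj₁ (subst (_≤ _) (∷-injectiveˡ eq) p≤x)
descentTop-++⁻ (p ∷ P) Q (_ ∷ P≤x)  (_ ∷ u , z , v , eq , y>z) =
  descentTop-++⁻ P Q P≤x (u , z , v , ∷-injectiveʳ eq , y>z)

increasing⇒¬descentTop : ∀ {w y} → Increasing w → ¬ DescentTop w y
increasing⇒¬descentTop inc (u , _ , _ , refl , y>z) = go u inc y>z
  where
  go : ∀ u {y z v} → Linked _<_ (u ++ y ∷ z ∷ v) → ¬ (y > z)
  go []      (y<z ∷ _) y>z = <-asym y<z y>z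
  go (_ ∷ u) inc       y>z = go u (Linked.tail inc) y>z

data LongLHook (x : ℕ) : List ℕ → Set where
  longLHook : ∀ a u → All (_≤ x) ((a ∷ u) ++ [ x ]) → LongLHook x ((a ∷ u) ++ [ x ])

lHook⇒longLHook : ∀ {α} → LHook α → 2 ≤ length α → ∃ λ x → LongLHook x α
lHook⇒longLHook (inj₁ (_ , refl))                   (s≤s ())
lHook⇒longLHook (inj₂ (_ , [] , _ , refl , _))      (s≤s ())
lHook⇒longLHook (inj₂ (_ , a ∷ u , x , refl , ≤x)) _ = x , longLHook a u ≤x

lastOr-longLHook : ∀ {d x α} → LongLHook x α → lastOr d α ≡ x
lastOr-longLHook (longLHook a u _) = go a u
  where
  go : ∀ {x} d u → lastOr d (u ++ [ x ]) ≡ x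
  go d []      = refl
  go d (a ∷ u) = go a u

data Dominated (m : ℕ) : List ℕ → Set where
  dominated : ∀ {r w} → r < m → (∀ y → DescentTop (r ∷ w) y → y < m) →
              Dominated m (r ∷ w)

dominated-++ : ∀ {x m α w} → LongLHook x α → x < m → Dominated x w →
               Dominated m (α ++ w)
dominated-++ {w = w} (longLHook a u ≤x@(a≤x ∷ _)) x<m (dominated _ tops<x) =
  dominated (≤-<-trans a≤x x<m) tops<m
  where
  tops<m : ∀ y → DescentTop (((a ∷ u) ++ [ _ ]) ++ w) y → y < _
  tops<m y d = [ (λ y≤x → ≤-<-trans y≤x x<m) , (λ d′ → <-trans (tops<x y d′) x<m) ]′
                 (descentTop-++⁻ _ w ≤x d)

greatestDescentTop-hook : ∀ {x w} u → All (_≤ x) (u ++ [ x ]) → Dominated x w →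
                          GreatestDescentTop (u ++ x ∷ w) x
greatestDescentTop-hook {x} {w} u ≤x (dominated r<x tops<x) =
  (u , _ , _ , refl , r<x) , bounded
  where
  bounded : ∀ y → DescentTop (u ++ x ∷ w) y → y ≤ x
  bounded y d = [ id , (λ d′ → <⇒≤ (tops<x y d′)) ]′
    (descentTop-++⁻ (u ++ [ x ]) w ≤x (subst (λ v → DescentTop v y) (sym (++-assoc u [ x ] w)) d))

rix-++ : ∀ {x α w αs β} → LongLHook x α → Dominated x w → Rix w αs β →
         Rix (α ++ w) (α ∷ αs) β
rix-++ {x} {w = w} {αs} {β} (longLHook a u ≤x) dom rix =
  subst (λ v → Rix v (((a ∷ u) ++ [ x ]) ∷ αs) β) (sym (++-assoc (a ∷ u) [ x ] w))
    (step (λ inc → increasing⇒¬descentTop inc (proj₁ greatest)) greatest rix)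
  where greatest = greatestDescentTop-hook (a ∷ u) ≤x dom

-- The bound on the dominating letter m is phrased as "m can be prepended to the
-- decreasing chain x₁ > ⋯ > xᵢ > β₁", i.e. m > x₁ (m > β₁ when i = 0).
rix-factorization : ∀ αs b bs →
  All (λ α → LHook α × 2 ≤ length α) αs →
  Linked _>_ (map (lastOr 0) αs ++ [ b ]) →
  (¬ Increasing (b ∷ bs) → GreatestDescentTop (b ∷ bs) b) →
  Rix (concat αs ++ b ∷ bs) αs (b ∷ bs)
    × (∀ {m} → Linked _>_ (m ∷ map (lastOr 0) αs ++ [ b ]) →
               Dominated m (concat αs ++ b ∷ bs))
rix-factorization [] b bs _ _ βtop = rix-β , λ m>b →
  dominated (Linked.head m>b) (λ y d → ≤-<-trans (tops≤b y d) (Linked.head m>b))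
  where
  rix-β : Rix (b ∷ bs) [] (b ∷ bs)
  rix-β with linked? _<?_ (b ∷ bs)
  ... | yes inc = stop-inc inc
  ... | no ¬inc = stop-empty ¬inc (βtop ¬inc)
  tops≤b : ∀ y → DescentTop (b ∷ bs) y → y ≤ b
  tops≤b y d = proj₂ (βtop (λ inc → increasing⇒¬descentTop inc d)) y d
rix-factorization (α ∷ αs) b bs ((hook , long) ∷ hooks) chain βtop
  with lHook⇒longLHook hook long
... | x , h rewrite ++-assoc α (concat αs) (b ∷ bs) =
  rix-++ h (dom chainₓ) rix , λ m≻ →
    dominated-++ h (subst (_< _) (lastOr-longLHook h) (Linked.head m≻)) (dom chainₓ)
  where
  chainₓ : Linked _>_ (x ∷ map (lastOr 0) αs ++ [ b ])
  chainₓ = subst (λ y → Linked _>_ (y ∷ _)) (lastOr-longLHook h) chain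
  ih = rix-factorization αs b bs hooks (Linked.tail chain) βtop
  rix = proj₁ ih
  dom = proj₂ ih

proposition3p3 : (n : ℕ) (σ : List ℕ) → IsPerm n σ →
    (αs : List (List ℕ)) (b : ℕ) (bs : List ℕ) →
    σ ≡ concat αs ++ (b ∷ bs) →
    All (λ α → LHook α × 2 ≤ length α) αs →
    (LHook (b ∷ bs) ⊎ FHook (b ∷ bs)) →
    Linked _>_ (map (lastOr 0) αs ++ [ b ]) →
    (¬ Increasing (b ∷ bs) → GreatestDescentTop (b ∷ bs) b) →
    Rix σ αs (b ∷ bs)
proposition3p3 _ _ _ αs b bs refl hooks _ chain βtop =
  proj₁ (rix-factorization αs b bs hooks chain βtop)
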